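{- Let $k$ be a positive integer and let $D$ be a digraph with a partition $\{X,Y\}$ of $V(D)$ such that $D[X]$ is traceable and $Y$ is a stable set of $D$. Suppose that either $|X|<k$, or there is a set $S\subseteq X$ with $|S|=k$ such that no vertex $y\in Y$ is adjacent to every vertex of $S$. Then $\pi_k(D)\leq \alpha_k(D)$.
   Context: Digraphs have no loops and no parallel arcs (directed 2-cycles are allowed). Paths are directed paths; the size $|P|$ of a path $P$ is its number of vertices. A digraph is traceable if it has a Hamiltonian path. A stable set of $D$ is a stable set of its underlying undirected graph; two vertices $u,v$ are adjacent if $(u,v)\in A(D)$ or $(v,u)\in A(D)$. A path partition of $D$ is a set of vertex-disjoint paths covering $V(D)$. The $k$-norm of a path partition $\mathcal{P}$ is $|\mathcal{P}|_k=\sum_{P\in\mathcal{P}}\min\{|P|,k\}$, and $\pi_k(D)$ is the minimum $k$-norm over all path partitions of $D$. A $k$-partial coloring is a set of $k$ pairwise disjoint stable sets (empty allowed); its weight is the sum of the sizes of its classes, and $\alpha_k(D)$ is the maximum weight of a $k$-partial coloring of $D$. -}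

module Defs where

open import Data.Nat using (ℕ; suc; _⊓_; _+_; _≤_; _<_)
open import Data.Fin using (Fin)
open import Data.Fin.Subset using (Subset; _∈_; _∉_; ∣_∣)
open import Data.List using (List; []; _∷_; concat; map; length; allFin)
open import Data.Nat.ListAction using (sum)
open import Data.List.Membership.Propositional using () renaming (_∈_ to _∈ₗ_)
open import Data.List.Relation.Unary.Unique.Propositional using (Unique)
open import Data.List.Relation.Unary.Linked using (Linked)
open import Data.List.Relation.Unary.All using (All)
open import Data.List.Relation.Binary.Permutation.Propositional using (_↭_)
open import Data.Product using (Σ; _×_; ∃)
open import Data.Sum using (_⊎_)
open import Relation.Nullary using (¬_; Dec)
open import Relation.Binary.PropositionalEquality using (_≡_)
open import Function.Bundles using (_⇔_)

-- A finite digraph on vertex set Fin n: an arc relation (decidable),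
-- without loops. Parallel arcs cannot occur (arcs form a relation);
-- directed 2-cycles (Arc u v and Arc v u) are allowed.
record Digraph : Set₁ where
  field
    n      : ℕ
    Arc    : Fin n → Fin n → Set
    arc?   : (u v : Fin n) → Dec (Arc u v)
    noLoop : (v : Fin n) → ¬ Arc v v

module _ (D : Digraph) where
  open Digraph D

  Adj : Fin n → Fin n → Set
  Adj u v = Arc u v ⊎ Arc v u

  record IsPath (P : List (Fin n)) : Set where
    field
      nonempty : 0 < length P
      distinct : Unique P
      arcs     : Linked Arc P

  record IsPathPartition (𝒫 : List (List (Fin n))) : Set where
    field
      paths  : All IsPath 𝒫
      covers : concat 𝒫 ↭ allFin n

  norm : ℕ → List (List (Fin n)) → ℕ
  norm k 𝒫 = sum (map (λ P → length P ⊓ k) 𝒫)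

  Stable : Subset n → Set
  Stable S = ∀ u v → u ∈ S → v ∈ S → ¬ Adj u v

  -- k-partial coloring: k pairwise disjoint stable sets (empty allowed)
  record IsPartialColoring (k : ℕ) (C : Fin k → Subset n) : Set where
    field
      stable   : ∀ i → Stable (C i)
      disjoint : ∀ i j → ¬ i ≡ j → ∀ v → v ∈ C i → v ∉ C j

  weight : (k : ℕ) → (Fin k → Subset n) → ℕ
  weight k C = sum (map (λ i → ∣ C i ∣) (allFin k))

  -- D[X] is traceable: there is a path of D whose vertex set is exactly X
  -- (a path inside X uses only arcs of D[X])
  Traceable : Subset n → Set
  Traceable X = ∃ λ P → IsPath P × (∀ v → (v ∈ₗ P) ⇔ (v ∈ X))

  -- π_k(D) ≤ α_k(D): the minimum k-norm of a path partition is at most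
  -- the maximum weight of a k-partial coloring, i.e. some path partition
  -- has k-norm at most the weight of some k-partial coloring.
  πk≤αk : ℕ → Set
  πk≤αk k = Σ (List (List (Fin n))) λ 𝒫 → Σ (Fin k → Subset n) λ C →
             IsPathPartition 𝒫 × IsPartialColoring k C × norm k 𝒫 ≤ weight k C

module Submission where

-- Cover D by a Hamiltonian path P of D[X] together with the singletons of Y = V(D) ∖ X; this path
-- partition has k-norm min(|X|, k) + |Y|. For the colouring choose min(|X|, k) anchors in X (all of
-- X when |X| < k, the set S otherwise), give the i-th anchor colour i, and give each y ∈ Y a colour
-- whose anchor is not adjacent to y: the unused colour |X| in the first case, the colour of a vertex
-- of S missed by y in the second. As Y is stable the classes are stable, and the weight is
-- min(|X|, k) + |Y|.

open import Defs
open import Data.Bool using (Bool; if_then_else_; true)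
open import Data.Empty using (⊥-elim)
open import Data.Fin using (Fin; zero; suc; toℕ; inject≤; fromℕ<; _≟_)
open import Data.Fin.Properties using (inject≤-injective; toℕ-inject≤; toℕ-fromℕ<; toℕ<n; ¬∀⟶∃¬)
open import Data.Fin.Subset using (Subset; _∈_; _⊆_; ∣_∣; ∁; inside; outside; ⁅_⁆)
open import Data.Fin.Subset.Properties using (_∈?_; x∈p⇒x∉∁p; x∉p⇒x∈∁p; x∈⁅y⁆⇔x≡y; ∣⁅x⁆∣≡1)
open import Data.List using (List; []; _∷_; _++_; filter; map; length; allFin; lookup; tabulate; [_])
open import Data.List.Membership.Propositional using () renaming (_∈_ to _∈ₗ_)
open import Data.List.Membership.Propositional.Properties using (∈-filter⁺; ∈-filter⁻; ∈-allFin; ∈-++⁺ˡ; ∈-++⁺ʳ)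
open import Data.List.Membership.Propositional.Properties.WithK using (unique∧set⇒bag)
open import Data.List.Properties using (map-tabulate; concat-map-[_])
open import Data.List.Relation.Binary.BagAndSetEquality using (∼bag⇒↭)
open import Data.List.Relation.Binary.Permutation.Propositional using (_↭_)
open import Data.List.Relation.Unary.All as All using (All; []; _∷_)
open import Data.List.Relation.Unary.AllPairs using ([]; _∷_)
open import Data.List.Relation.Unary.Any using (any?; index)
open import Data.List.Relation.Unary.Any.Properties using (lookup-index)
open import Data.List.Relation.Unary.Linked using ([-])
open import Data.List.Relation.Unary.Unique.Propositional using (Unique)
open import Data.List.Relation.Unary.Unique.Propositional.Properties using (filter⁺; allFin⁺; ++⁺)
open import Data.Maybe using (Maybe; just; nothing)
open import Data.Maybe.Properties using (just-injective; ≡-dec)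
open import Data.Nat using (ℕ; zero; suc; _+_; _⊓_; _≤_; _<_; z≤n; s≤s)
open import Data.Nat.ListAction using (sum)
open import Data.Nat.Properties using (+-0-commutativeMonoid; m⊓n≤m; m⊓n≤n; ≤-reflexive; <⇒≤; <-irrefl; +-monoˡ-≤; module ≤-Reasoning)
open import Algebra.Properties.CommutativeMonoid.Sum +-0-commutativeMonoid
  using (sum-syntax; sum-cong-≗; ∑-distrib-+; ∑-comm; sum-replicate-zero)
open import Data.Product using (Σ; ∃; _×_; _,_; proj₁; proj₂)
open import Data.Sum using (_⊎_; inj₁; inj₂; [_,_]′)
open import Data.Vec as Vec using ()
open import Data.Vec.Properties using (lookup∘tabulate; []=⇒lookup; lookup⇒[]=)
open import Function using (_∘_)
open import Function.Bundles using (_⇔_; mk⇔; Equivalence)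
open import Level using (Level)
open import Relation.Nullary using (¬_; Dec; yes; no; does; contradiction)
open import Relation.Nullary.Decidable using (does-⇔; dec-true; _⊎-dec_; _→-dec_)
open import Relation.Binary.PropositionalEquality using (_≡_; refl; sym; trans; cong; cong₂; subst; module ≡-Reasoning)

private variable
  a b : Level
  A : Set a
  B : Set b
  k m : ℕ

indicator : Dec A → ℕ
indicator a? = if does a? then 1 else 0

indicator-cong : A ⇔ B → (a? : Dec A) (b? : Dec B) → indicator a? ≡ indicator b?
indicator-cong A⇔B a? b? = cong (λ t → if t then 1 else 0) (does-⇔ A⇔B a? b?)

indicator-⊎ : ¬ (A × B) → (a? : Dec A) (b? : Dec B) → indicator (a? ⊎-dec b?) ≡ indicator a? + indicator b?
indicator-⊎ ¬a×b (yes a) (yes b) = contradiction (a , b) ¬a×b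
indicator-⊎ ¬a×b (yes a) (no _)  = refl
indicator-⊎ ¬a×b (no _)  b?      = refl

does≡true⇒ : (a? : Dec A) → does a? ≡ true → A
does≡true⇒ (yes a) _ = a

sum-tabulate : (f : Fin m → ℕ) → sum (tabulate f) ≡ ∑[ i < m ] f i
sum-tabulate {zero}  f = refl
sum-tabulate {suc m} f = cong (f zero +_) (sum-tabulate (f ∘ suc))

∣p∣≡∑ : (p : Subset m) → ∣ p ∣ ≡ ∑[ v < m ] indicator (v ∈? p)
∣p∣≡∑ Vec.[]            = refl
∣p∣≡∑ (inside  Vec.∷ p) = cong suc (∣p∣≡∑ p)
∣p∣≡∑ (outside Vec.∷ p) = ∣p∣≡∑ p

∑-indicator-≟ : (j : Fin k) → ∑[ i < k ] indicator (i ≟ j) ≡ 1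
∑-indicator-≟ {k} j = begin
  ∑[ i < k ] indicator (i ≟ j)      ≡⟨ sum-cong-≗ (λ i → sym (indicator-cong x∈⁅y⁆⇔x≡y (i ∈? ⁅ j ⁆) (i ≟ j))) ⟩
  ∑[ i < k ] indicator (i ∈? ⁅ j ⁆) ≡⟨ sym (∣p∣≡∑ ⁅ j ⁆) ⟩
  ∣ ⁅ j ⁆ ∣                         ≡⟨ ∣⁅x⁆∣≡1 j ⟩
  1                                 ∎
  where open ≡-Reasoning

_∈ₗ?_ : (v : Fin m) (xs : List (Fin m)) → Dec (v ∈ₗ xs)
v ∈ₗ? xs = any? (v ≟_) xs

_≟ᵐ_ : (c d : Maybe (Fin m)) → Dec (c ≡ d)
_≟ᵐ_ = ≡-dec _≟_

∑-indicator-∈ₗ : {xs : List (Fin m)} → Unique xs → ∑[ v < m ] indicator (v ∈ₗ? xs) ≡ length xs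
∑-indicator-∈ₗ {m} {[]} [] = sum-replicate-zero m
∑-indicator-∈ₗ {m} {x ∷ xs} (x∉xs ∷ xs-unique) = begin
  ∑[ v < m ] indicator (v ∈ₗ? (x ∷ xs))
    ≡⟨ sum-cong-≗ (λ v → indicator-⊎ head-disjoint (v ≟ x) (v ∈ₗ? xs)) ⟩
  ∑[ v < m ] (indicator (v ≟ x) + indicator (v ∈ₗ? xs))
    ≡⟨ ∑-distrib-+ (λ v → indicator (v ≟ x)) (λ v → indicator (v ∈ₗ? xs)) ⟩
  ∑[ v < m ] indicator (v ≟ x) + ∑[ v < m ] indicator (v ∈ₗ? xs)
    ≡⟨ cong₂ _+_ (∑-indicator-≟ x) (∑-indicator-∈ₗ xs-unique) ⟩
  suc (length xs) ∎
  where
  open ≡-Reasoning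
  head-disjoint : ∀ {v} → ¬ (v ≡ x × v ∈ₗ xs)
  head-disjoint (refl , x∈xs) = All.lookup x∉xs x∈xs refl

length≡∣∣ : {xs : List (Fin m)} {p : Subset m} → Unique xs → (∀ v → v ∈ₗ xs ⇔ v ∈ p) → length xs ≡ ∣ p ∣
length≡∣∣ {m} {xs} {p} xs-unique xs≈p = begin
  length xs                           ≡⟨ sym (∑-indicator-∈ₗ xs-unique) ⟩
  ∑[ v < m ] indicator (v ∈ₗ? xs)    ≡⟨ sum-cong-≗ (λ v → indicator-cong (xs≈p v) (v ∈ₗ? xs) (v ∈? p)) ⟩
  ∑[ v < m ] indicator (v ∈? p)       ≡⟨ sym (∣p∣≡∑ p) ⟩
  ∣ p ∣                               ∎
  where open ≡-Reasoning

unique-sameElements⇒↭ : {xs ys : List A} → Unique xs → Unique ys → (∀ {v} → v ∈ₗ xs ⇔ v ∈ₗ ys) → xs ↭ ys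
unique-sameElements⇒↭ xs-unique ys-unique xs≈ys = ∼bag⇒↭ (unique∧set⇒bag xs-unique ys-unique xs≈ys)

elements : Subset m → List (Fin m)
elements {m} p = filter (_∈? p) (allFin m)

elements-unique : (p : Subset m) → Unique (elements p)
elements-unique {m} p = filter⁺ (_∈? p) (allFin⁺ m)

∈-elements : (p : Subset m) → ∀ v → v ∈ₗ elements p ⇔ v ∈ p
∈-elements {m} p v = mk⇔ (proj₂ ∘ ∈-filter⁻ (_∈? p) {xs = allFin m}) (∈-filter⁺ (_∈? p) (∈-allFin v))

length-elements : (p : Subset m) → length (elements p) ≡ ∣ p ∣
length-elements p = length≡∣∣ (elements-unique p) (∈-elements p)

module _ (D : Digraph) where
  open Digraph D

  Adj-sym : ∀ {u v} → Adj D u v → Adj D v u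
  Adj-sym (inj₁ uv) = inj₂ uv
  Adj-sym (inj₂ vu) = inj₁ vu

  ∃-non-neighbour : (S : Subset n) {y : Fin n} → ¬ (∀ s → s ∈ S → Adj D y s) → ∃ λ s → s ∈ S × ¬ Adj D y s
  ∃-non-neighbour S {y} undominated
    with s , ¬[s∈S⇒y~s] ← ¬∀⟶∃¬ n (λ s → s ∈ S → Adj D y s) (λ s → (s ∈? S) →-dec (arc? y s ⊎-dec arc? s y)) undominated
    with s ∈? S
  ... | yes s∈S = s , s∈S , λ y~s → ¬[s∈S⇒y~s] (λ _ → y~s)
  ... | no  s∉S = ⊥-elim (¬[s∈S⇒y~s] (λ s∈S → contradiction s∈S s∉S))

  singletons-arePaths : (xs : List (Fin n)) → All (IsPath D) (map [_] xs)
  singletons-arePaths []       = []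
  singletons-arePaths (x ∷ xs) = record { nonempty = s≤s z≤n ; distinct = [] ∷ [] ; arcs = [-] } ∷ singletons-arePaths xs

  path+singletons-isPathPartition : {X : Subset n} {P : List (Fin n)} → IsPath D P → (∀ v → v ∈ₗ P ⇔ v ∈ X) →
    IsPathPartition D (P ∷ map [_] (elements (∁ X)))
  path+singletons-isPathPartition {X} {P} P-path P≈X = record
    { paths  = P-path ∷ singletons-arePaths (elements (∁ X))
    ; covers = subst (λ ys → P ++ ys ↭ allFin n) (sym (concat-map-[_] (elements (∁ X))))
        (unique-sameElements⇒↭ (++⁺ (IsPath.distinct P-path) (elements-unique (∁ X)) disjoint)
          (allFin⁺ n) (λ {v} → mk⇔ (λ _ → ∈-allFin v) (λ _ → covered v)))
    }
    where
    disjoint : ∀ {v} → ¬ (v ∈ₗ P × v ∈ₗ elements (∁ X))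
    disjoint {v} (v∈P , v∈Y) = x∈p⇒x∉∁p (Equivalence.to (P≈X v) v∈P) (Equivalence.to (∈-elements (∁ X) v) v∈Y)
    covered : ∀ v → v ∈ₗ P ++ elements (∁ X)
    covered v with v ∈? X
    ... | yes v∈X = ∈-++⁺ˡ (Equivalence.from (P≈X v) v∈X)
    ... | no  v∉X = ∈-++⁺ʳ P (Equivalence.from (∈-elements (∁ X) v) (x∉p⇒x∈∁p v∉X))

  norm-path+singletons : (P xs : List (Fin n)) → norm D (suc k) (P ∷ map [_] xs) ≡ length P ⊓ suc k + length xs
  norm-path+singletons {k} P xs = cong (length P ⊓ suc k +_) (singletons xs)
    where
    singletons : (xs : List (Fin n)) → sum (map (λ Q → length Q ⊓ suc k) (map [_] xs)) ≡ length xs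
    singletons []       = refl
    singletons (x ∷ xs) = cong suc (singletons xs)

  ProperColourMap : (Fin n → Maybe (Fin k)) → Set
  ProperColourMap c = ∀ {u v i} → c u ≡ just i → c v ≡ just i → ¬ Adj D u v

  colourClass : (Fin n → Maybe (Fin k)) → Fin k → Subset n
  colourClass c i = Vec.tabulate (λ v → does (c v ≟ᵐ just i))

  ∈-colourClass : (c : Fin n → Maybe (Fin k)) (i : Fin k) (v : Fin n) → v ∈ colourClass c i ⇔ c v ≡ just i
  ∈-colourClass c i v = mk⇔
    (λ v∈C → does≡true⇒ (c v ≟ᵐ just i) (trans (sym (lookup∘tabulate class v)) ([]=⇒lookup v∈C)))
    (λ cv≡i → lookup⇒[]= v (colourClass c i) (trans (lookup∘tabulate class v) (dec-true (c v ≟ᵐ just i) cv≡i)))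
    where
    class : Fin n → Bool
    class w = does (c w ≟ᵐ just i)

  colourClass-isPartialColoring : {c : Fin n → Maybe (Fin k)} → ProperColourMap c → IsPartialColoring D k (colourClass c)
  colourClass-isPartialColoring {c = c} proper = record
    { stable   = λ i u v u∈C v∈C → proper (member u∈C) (member v∈C)
    ; disjoint = λ i j i≢j v v∈Cᵢ v∈Cⱼ → i≢j (just-injective (trans (sym (member v∈Cᵢ)) (member v∈Cⱼ)))
    }
    where
    member : ∀ {i v} → v ∈ colourClass c i → c v ≡ just i
    member {i} {v} = Equivalence.to (∈-colourClass c i v)

  weight-colourClass : (c : Fin n → Maybe (Fin k)) →
    weight D k (colourClass c) ≡ ∑[ v < n ] ∑[ i < k ] indicator (c v ≟ᵐ just i)
  weight-colourClass {k} c = begin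
    sum (map (λ i → ∣ colourClass c i ∣) (allFin k))        ≡⟨ cong sum (map-tabulate (λ i → i) (λ i → ∣ colourClass c i ∣)) ⟩
    sum (tabulate (λ i → ∣ colourClass c i ∣))              ≡⟨ sum-tabulate (λ i → ∣ colourClass c i ∣) ⟩
    ∑[ i < k ] ∣ colourClass c i ∣                          ≡⟨ sum-cong-≗ (λ i → ∣p∣≡∑ (colourClass c i)) ⟩
    ∑[ i < k ] ∑[ v < n ] indicator (v ∈? colourClass c i)  ≡⟨ ∑-comm (λ i v → indicator (v ∈? colourClass c i)) ⟩
    ∑[ v < n ] ∑[ i < k ] indicator (v ∈? colourClass c i)  ≡⟨ sum-cong-≗ (λ v → sum-cong-≗ (λ i → membership v i)) ⟩
    ∑[ v < n ] ∑[ i < k ] indicator (c v ≟ᵐ just i)         ∎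
    where
    open ≡-Reasoning
    membership : ∀ v i → indicator (v ∈? colourClass c i) ≡ indicator (c v ≟ᵐ just i)
    membership v i = indicator-cong (∈-colourClass c i v) (v ∈? colourClass c i) (c v ≟ᵐ just i)

anchorColour : {L : List (Fin m)} {v : Fin m} → length L ≤ k → v ∈ₗ L → Fin k
anchorColour |L|≤k v∈L = inject≤ (index v∈L) |L|≤k

anchorColour-injective : {L : List (Fin m)} {u v : Fin m} (|L|≤k : length L ≤ k) (u∈L : u ∈ₗ L) (v∈L : v ∈ₗ L) →
  anchorColour |L|≤k u∈L ≡ anchorColour |L|≤k v∈L → u ≡ v
anchorColour-injective {L = L} |L|≤k u∈L v∈L same = begin
  _                     ≡⟨ lookup-index u∈L ⟩
  lookup L (index u∈L)  ≡⟨ cong (lookup L) (inject≤-injective |L|≤k |L|≤k (index u∈L) (index v∈L) same) ⟩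
  lookup L (index v∈L)  ≡⟨ sym (lookup-index v∈L) ⟩
  _                     ∎
  where open ≡-Reasoning

anchorColour<length : {L : List (Fin m)} {v : Fin m} (|L|≤k : length L ≤ k) (v∈L : v ∈ₗ L) →
  toℕ (anchorColour |L|≤k v∈L) < length L
anchorColour<length |L|≤k v∈L = subst (_< _) (sym (toℕ-inject≤ (index v∈L) |L|≤k)) (toℕ<n (index v∈L))

module AnchoredColouring (D : Digraph) (X : Subset (Digraph.n D)) (Y-stable : Stable D (∁ X))
  {L : List (Fin (Digraph.n D))} (L-unique : Unique L) (L⊆X : ∀ {v} → v ∈ₗ L → v ∈ X) (|L|≤k : length L ≤ k)
  (yColour : ∀ {y} → y ∈ ∁ X → Fin k)
  (yColour-avoids : ∀ {y u} (y∈Y : y ∈ ∁ X) (u∈L : u ∈ₗ L) → anchorColour |L|≤k u∈L ≡ yColour y∈Y → ¬ Adj D y u)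
  where
  open Digraph D

  colourOn : (v : Fin n) → Dec (v ∈ₗ L) → Dec (v ∈ ∁ X) → Maybe (Fin k)
  colourOn v (yes v∈L) _         = just (anchorColour |L|≤k v∈L)
  colourOn v (no _)    (yes v∈Y) = just (yColour v∈Y)
  colourOn v (no _)    (no _)    = nothing

  colour : Fin n → Maybe (Fin k)
  colour v = colourOn v (v ∈ₗ? L) (v ∈? ∁ X)

  colour-proper : ProperColourMap D colour
  colour-proper {u} {v} = proper (u ∈ₗ? L) (u ∈? ∁ X) (v ∈ₗ? L) (v ∈? ∁ X)
    where
    anchor-vs-Y : ∀ {u y i} (u∈L : u ∈ₗ L) (y∈Y : y ∈ ∁ X) →
      just (anchorColour |L|≤k u∈L) ≡ just i → just (yColour y∈Y) ≡ just i → ¬ Adj D u y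
    anchor-vs-Y u∈L y∈Y u↦i y↦i u~y = yColour-avoids y∈Y u∈L (just-injective (trans u↦i (sym y↦i))) (Adj-sym D u~y)

    proper : ∀ {u v i} u∈L? u∈Y? v∈L? v∈Y? → colourOn u u∈L? u∈Y? ≡ just i → colourOn v v∈L? v∈Y? ≡ just i → ¬ Adj D u v
    proper (yes u∈L) _ (yes v∈L) _ u↦i v↦i u~v
      with refl ← anchorColour-injective |L|≤k u∈L v∈L (just-injective (trans u↦i (sym v↦i)))
      = [ noLoop _ , noLoop _ ]′ u~v
    proper (yes u∈L) _         (no _) (yes v∈Y) u↦i v↦i     = anchor-vs-Y u∈L v∈Y u↦i v↦i
    proper (no _)    (yes u∈Y) (yes v∈L) _      u↦i v↦i u~v = anchor-vs-Y v∈L u∈Y v↦i u↦i (Adj-sym D u~v)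
    proper (no _)    (yes u∈Y) (no _) (yes v∈Y) _   _       = Y-stable _ _ u∈Y v∈Y
    proper (no _)    (no _)    _      _         ()  _
    proper (yes _)   _         (no _) (no _)    _   ()
    proper (no _)    (yes _)   (no _) (no _)    _   ()

  colour-multiplicity : ∀ v → ∑[ i < k ] indicator (colour v ≟ᵐ just i) ≡ indicator (v ∈ₗ? L) + indicator (v ∈? ∁ X)
  colour-multiplicity v = multiplicity (v ∈ₗ? L) (v ∈? ∁ X)
    where
    one-colour : (j : Fin k) → ∑[ i < k ] indicator (just j ≟ᵐ just i) ≡ 1
    one-colour j = trans (sum-cong-≗ (λ i → indicator-cong (mk⇔ sym sym) (j ≟ i) (i ≟ j))) (∑-indicator-≟ j)

    multiplicity : (v∈L? : Dec (v ∈ₗ L)) (v∈Y? : Dec (v ∈ ∁ X)) →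
      ∑[ i < k ] indicator (colourOn v v∈L? v∈Y? ≟ᵐ just i) ≡ indicator v∈L? + indicator v∈Y?
    multiplicity (yes v∈L) (yes v∈Y) = contradiction v∈Y (x∈p⇒x∉∁p (L⊆X v∈L))
    multiplicity (yes v∈L) (no _)    = one-colour (anchorColour |L|≤k v∈L)
    multiplicity (no _)    (yes v∈Y) = one-colour (yColour v∈Y)
    multiplicity (no _)    (no _)    = sum-replicate-zero k

  colouring : Fin k → Subset n
  colouring = colourClass D colour

  colouring-isPartialColoring : IsPartialColoring D k colouring
  colouring-isPartialColoring = colourClass-isPartialColoring D colour-proper

  weight-colouring : weight D k colouring ≡ length L + ∣ ∁ X ∣
  weight-colouring = begin
    weight D k colouring                                              ≡⟨ weight-colourClass D colour ⟩
    ∑[ v < n ] ∑[ i < k ] indicator (colour v ≟ᵐ just i)              ≡⟨ sum-cong-≗ colour-multiplicity ⟩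
    ∑[ v < n ] (indicator (v ∈ₗ? L) + indicator (v ∈? ∁ X))           ≡⟨ ∑-distrib-+ (λ v → indicator (v ∈ₗ? L)) (λ v → indicator (v ∈? ∁ X)) ⟩
    ∑[ v < n ] indicator (v ∈ₗ? L) + ∑[ v < n ] indicator (v ∈? ∁ X)  ≡⟨ cong₂ _+_ (∑-indicator-∈ₗ L-unique) (sym (∣p∣≡∑ (∁ X))) ⟩
    length L + ∣ ∁ X ∣                                                ∎
    where open ≡-Reasoning

module _ (D : Digraph) (X : Subset (Digraph.n D)) (X-traceable : Traceable D X) (Y-stable : Stable D (∁ X)) where
  open Digraph D

  private
    P : List (Fin n)
    P = proj₁ X-traceable

    P-path : IsPath D P
    P-path = proj₁ (proj₂ X-traceable)

    P≈X : ∀ v → v ∈ₗ P ⇔ v ∈ X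
    P≈X = proj₂ (proj₂ X-traceable)

  length-hamiltonianPath : length P ≡ ∣ X ∣
  length-hamiltonianPath = length≡∣∣ (IsPath.distinct P-path) P≈X

  πk≤αk-fromAnchors : {L : List (Fin n)} → Unique L → (∀ {v} → v ∈ₗ L → v ∈ X) →
    (|L|≤k : length L ≤ suc k) → ∣ X ∣ ⊓ suc k ≤ length L →
    (yColour : ∀ {y} → y ∈ ∁ X → Fin (suc k)) →
    (∀ {y u} (y∈Y : y ∈ ∁ X) (u∈L : u ∈ₗ L) → anchorColour |L|≤k u∈L ≡ yColour y∈Y → ¬ Adj D y u) →
    πk≤αk D (suc k)
  πk≤αk-fromAnchors {k} {L} L-unique L⊆X |L|≤k enough-anchors yColour yColour-avoids =
    P ∷ map [_] (elements (∁ X)) , colouring , path+singletons-isPathPartition D P-path P≈X ,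
    colouring-isPartialColoring , norm≤weight
    where
    open AnchoredColouring D X Y-stable L-unique L⊆X |L|≤k yColour yColour-avoids
    open ≤-Reasoning
    norm≤weight : norm D (suc k) (P ∷ map [_] (elements (∁ X))) ≤ weight D (suc k) colouring
    norm≤weight = begin
      norm D (suc k) (P ∷ map [_] (elements (∁ X)))  ≡⟨ norm-path+singletons D P (elements (∁ X)) ⟩
      length P ⊓ suc k + length (elements (∁ X))     ≡⟨ cong₂ (λ p y → p ⊓ suc k + y) length-hamiltonianPath (length-elements (∁ X)) ⟩
      ∣ X ∣ ⊓ suc k + ∣ ∁ X ∣                        ≤⟨ +-monoˡ-≤ ∣ ∁ X ∣ enough-anchors ⟩
      length L + ∣ ∁ X ∣                             ≡⟨ sym weight-colouring ⟩
      weight D (suc k) colouring                     ∎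

  πk≤αk-small : ∣ X ∣ < suc k → πk≤αk D (suc k)
  πk≤αk-small {k} |X|<k =
    πk≤αk-fromAnchors (IsPath.distinct P-path) (Equivalence.to (P≈X _)) (<⇒≤ |P|<k)
      (subst (λ p → ∣ X ∣ ⊓ suc k ≤ p) (sym length-hamiltonianPath) (m⊓n≤m ∣ X ∣ (suc k)))
      (λ _ → fromℕ< |P|<k) unused-colour
    where
    |P|<k : length P < suc k
    |P|<k = subst (_< suc k) (sym length-hamiltonianPath) |X|<k
    -- The anchors only use the colours below |P|, so colour |P| is free for the whole stable set Y.
    unused-colour : ∀ {y u} (y∈Y : y ∈ ∁ X) (u∈P : u ∈ₗ P) → anchorColour (<⇒≤ |P|<k) u∈P ≡ fromℕ< |P|<k → ¬ Adj D y u
    unused-colour _ u∈P same = contradiction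
      (subst (_< length P) (trans (cong toℕ same) (toℕ-fromℕ< |P|<k)) (anchorColour<length (<⇒≤ |P|<k) u∈P))
      (<-irrefl refl)

  πk≤αk-undominated : (S : Subset n) → S ⊆ X → ∣ S ∣ ≡ suc k → (∀ y → y ∈ ∁ X → ¬ (∀ s → s ∈ S → Adj D y s)) →
    πk≤αk D (suc k)
  πk≤αk-undominated {k} S S⊆X |S|≡k undominated =
    πk≤αk-fromAnchors (elements-unique S) (S⊆X ∘ Equivalence.to (∈-elements S _)) |L|≤k
      (subst (λ l → ∣ X ∣ ⊓ suc k ≤ l) (sym |L|≡k) (m⊓n≤n ∣ X ∣ (suc k)))
      (λ y∈Y → anchorColour |L|≤k (non-neighbour∈L y∈Y)) avoids
    where
    |L|≡k : length (elements S) ≡ suc k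
    |L|≡k = trans (length-elements S) |S|≡k
    |L|≤k : length (elements S) ≤ suc k
    |L|≤k = ≤-reflexive |L|≡k
    non-neighbour : ∀ {y} → y ∈ ∁ X → ∃ λ s → s ∈ S × ¬ Adj D y s
    non-neighbour y∈Y = ∃-non-neighbour D S (undominated _ y∈Y)
    non-neighbour∈L : ∀ {y} (y∈Y : y ∈ ∁ X) → proj₁ (non-neighbour y∈Y) ∈ₗ elements S
    non-neighbour∈L y∈Y = Equivalence.from (∈-elements S _) (proj₁ (proj₂ (non-neighbour y∈Y)))
    avoids : ∀ {y u} (y∈Y : y ∈ ∁ X) (u∈L : u ∈ₗ elements S) →
      anchorColour |L|≤k u∈L ≡ anchorColour |L|≤k (non-neighbour∈L y∈Y) → ¬ Adj D y u
    avoids y∈Y u∈L same with refl ← anchorColour-injective |L|≤k u∈L (non-neighbour∈L y∈Y) same =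
      proj₂ (proj₂ (non-neighbour y∈Y))

theorem1 : (k : ℕ) → 0 < k → (D : Digraph) → (X : Subset (Digraph.n D)) →
    Traceable D X → Stable D (∁ X) →
    (∣ X ∣ < k ⊎ Σ (Subset (Digraph.n D)) (λ S → S ⊆ X × ∣ S ∣ ≡ k ×
        (∀ y → y ∈ ∁ X → ¬ (∀ s → s ∈ S → Adj D y s)))) →
    πk≤αk D k
theorem1 (suc k) _ D X X-traceable Y-stable (inj₁ |X|<k) =
  πk≤αk-small D X X-traceable Y-stable |X|<k
theorem1 (suc k) _ D X X-traceable Y-stable (inj₂ (S , S⊆X , |S|≡k , undominated)) =
  πk≤αk-undominated D X X-traceable Y-stable S S⊆X |S|≡k undominated
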